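{- Let $p$ be a prime. There is no field $F$ whose multiplicative group $F^{\times}$ is isomorphic to the quasicyclic group $C_{p^{\infty}}$.
   Context: The quasicyclic (Prüfer) $p$-group $C_{p^{\infty}}$ is the union $\bigcup_{n \geq 0} C_{p^{n}}$ of the cyclic groups of order $p^{n}$ (e.g. the group of all complex $p^{n}$-th roots of unity for all $n$); equivalently $\mathbb{Z}[1/p]/\mathbb{Z}$. -}

module Defs where

open import Level using (Level; _⊔_) renaming (suc to lsuc)
open import Data.Nat using (ℕ; _^_; _+_)
open import Data.Integer using (ℤ; +_; -_; _-_) renaming (_*_ to _*ℤ_; _+_ to _+ℤ_)
open import Data.Integer.Divisibility using (_∣_)
open import Data.Product using (Σ; _×_; ∃)
open import Data.Sum using (_⊎_)
open import Relation.Nullary using (¬_)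
open import Algebra.Bundles using (CommutativeRing)
open import Algebra.Definitions using (Invertible)

-- Agda is constructive, so we use the standard constructive
-- notion of a (discrete) field: a nontrivial commutative ring in which
-- every element is either zero or invertible.  Classically this is
-- exactly the usual notion of a field.

record DiscreteField (c ℓ : Level) : Set (lsuc (c ⊔ ℓ)) where
  field
    commutativeRing : CommutativeRing c ℓ
  open CommutativeRing commutativeRing public
  field
    0≉1            : ¬ (0# ≈ 1#)
    zero-or-unit   : ∀ x → (x ≈ 0#) ⊎ Invertible _≈_ 1# _*_ x

-- The quasicyclic (Prüfer) p-group  C_{p^∞} = ℤ[1/p]/ℤ.
-- An element is represented by a pair (a , n) standing for the class
-- of a / p^n modulo ℤ.

Cp∞ : Set
Cp∞ = ℤ × ℕ

module _ (p : ℕ) where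

  private
    P : ℕ → ℤ
    P k = + (p ^ k)

  -- a/p^n ≡ b/p^m (mod ℤ)  iff  p^(n+m) ∣ a p^m - b p^n
  _≈Cp_ : Cp∞ → Cp∞ → Set
  (a Data.Product., n) ≈Cp (b Data.Product., m) =
    P (n + m) ∣ (a *ℤ P m - b *ℤ P n)

  -- group operation: a/p^n + b/p^m = (a p^m + b p^n)/p^(n+m)
  _⊕Cp_ : Cp∞ → Cp∞ → Cp∞
  (a Data.Product., n) ⊕Cp (b Data.Product., m) =
    (a *ℤ P m +ℤ b *ℤ P n) Data.Product., (n + m)

record MultGroupIsoCp∞ {c ℓ} (p : ℕ) (F : DiscreteField c ℓ) : Set (c ⊔ ℓ) where
  open DiscreteField F
  field
    ψ           : Cp∞ → Carrier
    ψ-nonzero   : ∀ x → ¬ (ψ x ≈ 0#)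
    ψ-cong      : ∀ x y → _≈Cp_ p x y → ψ x ≈ ψ y
    ψ-hom       : ∀ x y → ψ (_⊕Cp_ p x y) ≈ ψ x * ψ y
    ψ-injective : ∀ x y → ψ x ≈ ψ y → _≈Cp_ p x y
    ψ-surjective : ∀ y → ¬ (y ≈ 0#) → ∃ λ x → ψ x ≈ y

{-# OPTIONS --safe #-}

-- Suppose ψ : C_{p^∞} ≅ F^×.  Every unit of F then has p-power order, so either 2 = 0 or
-- some power of 2 is 1 in F; either way F has a prime characteristic r.  Moreover r ≠ p,
-- since an element ζ of order p would give (ζ - 1)^p = ζ^p - 1 = 0, and for odd p the unit
-- -1 has order 2, so r = 2.
--
-- Let N = p^w be the exact power of p dividing r^e - 1, so r^e = 1 + N·o with p ∤ o.  The
-- e-th power of Frobenius fixes every N-th root of unity ζ, hence also ζ + 1, whose order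
-- therefore divides N·o and so N: (ζ + 1)^(N+1) = ζ + 1.  Hence T n = Σ_ζ (ζ + 1)^n
-- satisfies T (N + k) = T k for k ≥ 1.  Expanding both sides binomially, where the power
-- sums Σ_ζ ζ^j are N or 0 according as N ∣ j or not, gives C(N + k, N)·N = 0 in F for
-- 0 < k < N.
--
-- For odd p choose w even (lifting the exponent once if necessary), so that N ≡ 1 (mod 4)
-- and C(N + 2, N)·N is odd, which is absurd in characteristic 2.  For p = 2, k = 1 gives
-- N + 1 = 0 both for N = 2^(w+2) and for 2N, the exact powers of 2 in r² - 1 and r⁴ - 1;
-- then 0 = 2 (N + 1) = (2N + 1) + 1 = 1.

module Submission where

open import Defs
open import Algebra.Bundles using (CommutativeMonoid; CommutativeSemiring)
open import Algebra.Definitions using (AlmostLeftCancellative; Invertible)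
open import Data.Nat as ℕ using (ℕ; zero; suc; _∸_; z<s; s<s)
import Data.Nat.Properties as ℕ
open import Data.Nat.Combinatorics using (_C_; nCn≡1; nC1≡n)
open import Data.Nat.Divisibility using (divides)
open import Data.Nat.Primality using (Prime; prime[2]; prime⇒nonZero; prime⇒nonTrivial)
open import Data.Fin using (toℕ; inject₁; fromℕ)
open import Data.Fin.Properties using (toℕ-inject₁; toℕ-fromℕ; toℕ<n)
open import Data.Vec.Functional using (Vector; head; tail)
open import Data.Product using (_,_; ∃-syntax) renaming (_×_ to _∧_)
open import Data.List using ([]; _∷_)
open import Data.List.Relation.Unary.All using (All; []; _∷_)
open import Data.Nat.ListAction using (product)
open import Data.Nat.Primality.Factorisation using (PrimeFactorisation; factorise)
open import Data.Sum using (inj₁; inj₂)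
open import Function using (_∘_; _|>_)
open import Relation.Nullary using (¬_; yes; no; contradiction)
open import Relation.Binary.PropositionalEquality as ≡ using (_≡_; _≢_)

module Arithmetic where
  open import Data.Nat
  open import Data.Nat.Properties
  open import Data.Nat.Divisibility
  open import Data.Nat.Primality
  open import Data.Nat.Combinatorics using (_C_; nC1≡n; nCk≡nC[n∸k]; nCk+nC[k+1]≡[n+1]C[k+1])
  open import Data.Nat.DivMod using (_%_; _/_; m%n<n; m≡m%n+[m/n]*n)
  open import Data.Nat.Induction using (<-rec)
  open import Algebra.Properties.CommutativeSemigroup *-commutativeSemigroup using (x∙yz≈z∙xy)
  open import Data.Nat.Tactic.RingSolver using (solve-∀)
  open import Data.Fin using (Fin; toℕ; fromℕ<)
  open import Data.Fin.Properties using (pigeonhole; toℕ-fromℕ<)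
  open import Data.Product using (∃-syntax; ∃₂; _×_; _,_)
  open import Data.Sum using (_⊎_; inj₁; inj₂; [_,_]′)
  open import Function using (_∘_; id; flip)
  open import Relation.Nullary using (¬_; yes; no; contradiction)
  open import Relation.Binary.PropositionalEquality
  open ≡-Reasoning

  private
    variable
      a m n o p : ℕ

  [1+k]*[1+n]C[1+k]≡[1+n]*nCk : ∀ n k → suc k * (suc n C suc k) ≡ suc n * (n C k)
  [1+k]*[1+n]C[1+k]≡[1+n]*nCk zero    zero    = refl
  [1+k]*[1+n]C[1+k]≡[1+n]*nCk zero    (suc k) = *-zeroʳ (2 + k)
  [1+k]*[1+n]C[1+k]≡[1+n]*nCk (suc n) zero    =
    trans (*-identityˡ _) (trans (nC1≡n (2 + n)) (sym (*-identityʳ (2 + n))))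
  [1+k]*[1+n]C[1+k]≡[1+n]*nCk (suc n) (suc k) = begin
    (2 + k) * ((2 + n) C (2 + k))          ≡⟨ cong ((2 + k) *_) (nCk+nC[k+1]≡[n+1]C[k+1] (suc n) (suc k)) ⟨
    (2 + k) * (D + E)                      ≡⟨ *-distribˡ-+ (2 + k) D E ⟩
    D + (1 + k) * D + (2 + k) * E          ≡⟨ +-assoc D _ _ ⟩
    D + ((1 + k) * D + (2 + k) * E)        ≡⟨ cong (D +_) (cong₂ _+_ ([1+k]*[1+n]C[1+k]≡[1+n]*nCk n k)
                                                                  ([1+k]*[1+n]C[1+k]≡[1+n]*nCk n (suc k))) ⟩
    D + ((1 + n) * A + (1 + n) * B)        ≡⟨ cong (D +_) (*-distribˡ-+ (1 + n) A B) ⟨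
    D + (1 + n) * (A + B)                  ≡⟨ cong (λ s → D + (1 + n) * s) (nCk+nC[k+1]≡[n+1]C[k+1] n k) ⟩
    (2 + n) * D                            ∎
    where
    A = n C k
    B = n C suc k
    D = suc n C suc k
    E = suc n C suc (suc k)

  2*[1+n]C2≡[1+n]*n : ∀ n → 2 * (suc n C 2) ≡ suc n * n
  2*[1+n]C2≡[1+n]*n n = trans ([1+k]*[1+n]C[1+k]≡[1+n]*nCk n 1) (cong (suc n *_) (nC1≡n n))

  [m+n]Cm≡[m+n]Cn : ∀ m n → (m + n) C m ≡ (m + n) C n
  [m+n]Cm≡[m+n]Cn m n = trans (nCk≡nC[n∸k] (m≤m+n m n)) (cong ((m + n) C_) (m+n∸m≡n m n))

  p∣pCk : ∀ {k} → Prime p → 0 < k → k < p → p ∣ p C k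
  p∣pCk {suc p} {suc k} pp _ k<p
    with euclidsLemma (suc k) (suc p C suc k) pp
           (divides (p C k) (trans ([1+k]*[1+n]C[1+k]≡[1+n]*nCk p k) (*-comm (suc p) _)))
  ... | inj₁ p∣1+k = contradiction (∣⇒≤ p∣1+k) (<⇒≱ k<p)
  ... | inj₂ p∣pCk = p∣pCk

  prime∤1 : Prime p → ¬ p ∣ 1
  prime∤1 {p} pp p∣1 = <-irrefl refl (subst (1 <_) (∣1⇒≡1 p∣1) (nonTrivial⇒n>1 p {{prime⇒nonTrivial pp}}))

  p∤1+p*n : Prime p → ¬ p ∣ suc (p * n)
  p∤1+p*n {p} {n} pp p∣1+pn = prime∤1 pp (∣m+n∣m⇒∣n (subst (p ∣_) (+-comm 1 (p * n)) p∣1+pn) (m∣m*n n))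

  ∤-* : Prime p → ¬ p ∣ m → ¬ p ∣ n → ¬ p ∣ m * n
  ∤-* {m = m} {n} pp p∤m p∤n = [ p∤m , p∤n ]′ ∘ euclidsLemma m n pp

  ∤-^ : Prime p → ¬ p ∣ a → ∀ n → ¬ p ∣ a ^ n
  ∤-^ pp p∤a zero    = prime∤1 pp
  ∤-^ pp p∤a (suc n) = ∤-* pp p∤a (∤-^ pp p∤a n)

  p^k∣o*n⇒p^k∣n : Prime p → ¬ p ∣ o → ∀ k {n} → p ^ k ∣ o * n → p ^ k ∣ n
  p^k∣o*n⇒p^k∣n pp p∤o zero {n} _ = 1∣ n
  p^k∣o*n⇒p^k∣n {p} {o} pp p∤o (suc k) {n} p^[1+k]∣on with euclidsLemma o n pp (m*n∣⇒m∣ p (p ^ k) p^[1+k]∣on)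
  ... | inj₁ p∣o = contradiction p∣o p∤o
  ... | inj₂ (divides c refl) = subst (p * p ^ k ∣_) (*-comm p c) (*-monoʳ-∣ p p^k∣c)
    where
    instance _ = prime⇒nonZero pp
    p^k∣c : p ^ k ∣ c
    p^k∣c = p^k∣o*n⇒p^k∣n pp p∤o k (*-cancelˡ-∣ p (subst (p * p ^ k ∣_) (x∙yz≈z∙xy o c p) p^[1+k]∣on))

  even⊎odd : ∀ n → ∃[ h ] (n ≡ 2 * h ⊎ n ≡ suc (2 * h))
  even⊎odd zero    = 0 , inj₁ refl
  even⊎odd (suc n) with even⊎odd n
  ... | h , inj₁ n≡2h   = h , inj₂ (cong suc n≡2h)
  ... | h , inj₂ n≡1+2h = suc h , inj₁ (trans (cong suc n≡1+2h) (sym (*-suc 2 h)))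

  ∤2⇒odd : ¬ 2 ∣ n → ∃[ h ] n ≡ suc (2 * h)
  ∤2⇒odd {n} 2∤n with even⊎odd n
  ... | h , inj₁ n≡2h   = contradiction (divides h (trans n≡2h (*-comm 2 h))) 2∤n
  ... | h , inj₂ n≡1+2h = h , n≡1+2h

  prime≢2⇒2∤p : Prime p → p ≢ 2 → ¬ 2 ∣ p
  prime≢2⇒2∤p pp p≢2 2∣p = [ (λ ()) , p≢2 ∘ sym ]′ (prime⇒irreducible pp 2∣p)

  oddPrime : Prime p → p ≢ 2 → ∃[ h ] p ≡ 3 + 2 * h
  oddPrime pp p≢2 with ∤2⇒odd (prime≢2⇒2∤p pp p≢2)
  ... | zero  , refl   = contradiction (∣-refl {1}) (prime∤1 pp)
  ... | suc h , p≡1+2h = h , trans p≡1+2h (cong suc (*-suc 2 h))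

  infix 4 _^_∥_
  _^_∥_ : ℕ → ℕ → ℕ → Set
  p ^ w ∥ n = ∃[ o ] n ≡ p ^ w * o × ¬ p ∣ o

  ∃-exactPower : Prime p → 0 < n → ∃[ w ] p ^ w ∥ n
  ∃-exactPower {p} {n} pp = <-rec (λ n → 0 < n → ∃[ w ] p ^ w ∥ n) split n
    where
    split : ∀ n → (∀ {m} → m < n → 0 < m → ∃[ w ] p ^ w ∥ m) → 0 < n → ∃[ w ] p ^ w ∥ n
    split n rec n>0 with p ∣? n
    ... | no  p∤n = 0 , n , sym (+-identityʳ n) , p∤n
    ... | yes (divides q refl) with rec q<qp q>0
      where
      q>0 : 0 < q
      q>0 = n≢0⇒n>0 λ { refl → <⇒≢ n>0 refl }
      q<qp : q < q * p
      q<qp = m<m*n q p {{>-nonZero q>0}} (nonTrivial⇒n>1 p {{prime⇒nonTrivial pp}})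
    ...   | w , o , q≡p^wo , p∤o =
      suc w , o , trans (cong (_* p) q≡p^wo) (trans (*-comm (p ^ w * o) p) (sym (*-assoc p (p ^ w) o))) , p∤o

  %≡%⇒∣∸ : ∀ x y n .{{_ : NonZero n}} → x % n ≡ y % n → n ∣ y ∸ x
  %≡%⇒∣∸ x y n x%n≡y%n = divides (y / n ∸ x / n) (begin
    y ∸ x                                      ≡⟨ cong₂ _∸_ (m≡m%n+[m/n]*n y n) (m≡m%n+[m/n]*n x n) ⟩
    (y % n + y / n * n) ∸ (x % n + x / n * n)  ≡⟨ cong (λ r → (y % n + y / n * n) ∸ (r + x / n * n)) x%n≡y%n ⟩
    (y % n + y / n * n) ∸ (y % n + x / n * n)  ≡⟨ [m+n]∸[m+o]≡n∸o (y % n) _ _ ⟩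
    y / n * n ∸ x / n * n                      ≡⟨ *-distribʳ-∸ n (y / n) (x / n) ⟨
    (y / n ∸ x / n) * n                        ∎)

  ∃-power≡1-mod : Prime p → ¬ p ∣ a → ∃[ d ] p ∣ a ^ suc d ∸ 1
  ∃-power≡1-mod {p} {a} pp p∤a with pigeonhole (n<1+n p) residue
    where
    instance _ = prime⇒nonZero pp
    residue : Fin (suc p) → Fin p
    residue i = fromℕ< (m%n<n (a ^ toℕ i) p)
  ... | i , j , i<j , residues≡ with m≤n⇒∃[o]m+o≡n i<j
  ...   | d , 1+i+d≡j =
    d , [ flip contradiction (∤-^ pp p∤a (toℕ i)) , id ]′ (euclidsLemma x _ pp p∣a^i*[a^[1+d]∸1])
    where
    instance _ = prime⇒nonZero pp
    x = a ^ toℕ i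
    y = a ^ toℕ j
    x%p≡y%p : x % p ≡ y % p
    x%p≡y%p = trans (sym (toℕ-fromℕ< (m%n<n x p))) (trans (cong toℕ residues≡) (toℕ-fromℕ< (m%n<n y p)))
    y∸x≡ : y ∸ x ≡ x * (a ^ suc d ∸ 1)
    y∸x≡ = begin
      y ∸ x                        ≡⟨ cong (λ e → a ^ e ∸ x) (trans (sym 1+i+d≡j) (sym (+-suc (toℕ i) d))) ⟩
      a ^ (toℕ i + suc d) ∸ x      ≡⟨ cong (_∸ x) (^-distribˡ-+-* a (toℕ i) (suc d)) ⟩
      x * a ^ suc d ∸ x            ≡⟨ cong (x * a ^ suc d ∸_) (*-identityʳ x) ⟨
      x * a ^ suc d ∸ x * 1        ≡⟨ *-distribˡ-∸ x (a ^ suc d) 1 ⟨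
      x * (a ^ suc d ∸ 1)          ∎
    p∣a^i*[a^[1+d]∸1] : p ∣ x * (a ^ suc d ∸ 1)
    p∣a^i*[a^[1+d]∸1] = subst (p ∣_) y∸x≡ (%≡%⇒∣∸ x y p x%p≡y%p)

  [3+2h]C2≡[3+2h]*[1+h] : ∀ h → (3 + 2 * h) C 2 ≡ (3 + 2 * h) * suc h
  [3+2h]C2≡[3+2h]*[1+h] h =
    *-cancelˡ-≡ ((3 + 2 * h) C 2) ((3 + 2 * h) * suc h) 2 (trans (2*[1+n]C2≡[1+n]*n (2 + 2 * h)) (halve h))
    where
    halve : ∀ h → (3 + 2 * h) * (2 + 2 * h) ≡ 2 * ((3 + 2 * h) * suc h)
    halve = solve-∀

  binomial-cubic : ∀ m i → ∃[ c ] suc m ^ i ≡ 1 + i * m + (i C 2) * (m * m) + c * (m * m * m)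
  binomial-cubic m zero    = 0 , refl
  binomial-cubic m (suc i) with binomial-cubic m i
  ... | c , [1+m]^i≡ = c′ , (begin
    suc m * suc m ^ i
      ≡⟨ cong (suc m *_) [1+m]^i≡ ⟩
    suc m * (1 + i * m + (i C 2) * (m * m) + c * (m * m * m))
      ≡⟨ expand m i (i C 2) c ⟩
    1 + suc i * m + (i + i C 2) * (m * m) + c′ * (m * m * m)
      ≡⟨ cong (λ b → 1 + suc i * m + b * (m * m) + c′ * (m * m * m)) pascal ⟩
    1 + suc i * m + (suc i C 2) * (m * m) + c′ * (m * m * m)
      ∎)
    where
    c′ = c + i C 2 + c * m
    pascal : i + i C 2 ≡ suc i C 2
    pascal = trans (cong (_+ i C 2) (sym (nC1≡n i))) (nCk+nC[k+1]≡[n+1]C[k+1] i 1)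
    expand : ∀ m i b c → suc m * (1 + i * m + b * (m * m) + c * (m * m * m)) ≡
                         1 + suc i * m + (i + b) * (m * m) + (c + b + c * m) * (m * m * m)
    expand = solve-∀

  -- (1 + m)^p ≡ 1 + p·m (mod p·m²) because p ∣ C(p, 2) for odd p.
  ∥-lift : ∀ {x w} → Prime p → p ≢ 2 → 0 < x → p ^ suc w ∥ x ∸ 1 → p ^ suc (suc w) ∥ x ^ p ∸ 1
  ∥-lift {p} {suc m} {w} pp p≢2 _ (o , refl , p∤o) with oddPrime pp p≢2 | binomial-cubic m p
  ... | h , p≡3+2h | c , [1+m]^p≡ = o * suc (p * v) , cong (_∸ 1) (begin
    suc m ^ p
      ≡⟨ [1+m]^p≡ ⟩
    1 + p * m + (p C 2) * (m * m) + c * (m * m * m)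
      ≡⟨ cong (λ b → 1 + p * m + b * (m * m) + c * (m * m * m)) pC2≡ ⟩
    1 + p * m + p * suc h * (m * m) + c * (m * m * m)
      ≡⟨ factor p (suc h) (p ^ w) o c ⟩
    suc (p ^ suc (suc w) * (o * suc (p * v)))
      ∎) , ∤-* pp p∤o (p∤1+p*n {n = v} pp)
    where
    v = suc h * (p ^ w * o) + c * (p ^ w * o) * (p ^ w * o)
    pC2≡ : p C 2 ≡ p * suc h
    pC2≡ = subst (λ q → q C 2 ≡ q * suc h) (sym p≡3+2h) ([3+2h]C2≡[3+2h]*[1+h] h)
    factor : ∀ p g x o c → let m = p * x * o in
             1 + p * m + p * g * (m * m) + c * (m * m * m) ≡
             suc (p * (p * x) * (o * suc (p * (g * (x * o) + c * (x * o) * (x * o)))))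
    factor = solve-∀

  ∥-lift-2 : ∀ {x w} → 0 < x → 2 ^ suc (suc w) ∥ x ∸ 1 → 2 ^ suc (suc (suc w)) ∥ x ^ 2 ∸ 1
  ∥-lift-2 {suc m} {w} _ (o , refl , 2∤o) =
    o * suc (2 * (2 ^ w * o)) , cong (_∸ 1) (factor (2 ^ w) o) , ∤-* prime[2] 2∤o (p∤1+p*n {n = 2 ^ w * o} prime[2])
    where
    factor : ∀ x o → let m = 2 * (2 * x) * o in
             suc m * (suc m * 1) ≡ suc (2 * (2 * (2 * x)) * (o * suc (2 * (x * o))))
    factor = solve-∀

  prime≢2⇒p∤2 : Prime p → p ≢ 2 → ¬ p ∣ 2
  prime≢2⇒p∤2 pp p≢2 p∣2 with prime⇒irreducible prime[2] p∣2
  ... | inj₁ refl = prime∤1 pp (∣-refl {1})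
  ... | inj₂ p≡2  = p≢2 p≡2

  oddValuation : Prime p → p ≢ 2 → ∃₂ λ e s → p ^ suc (suc (2 * s)) ∥ 2 ^ e ∸ 1
  oddValuation {p} pp p≢2 with ∃-power≡1-mod pp (prime≢2⇒p∤2 pp p≢2)
  ... | d , p∣2^[1+d]∸1 with ∃-exactPower pp (m<n⇒0<n∸m (^-monoʳ-< 2 (s≤s (s≤s z≤n)) {0} {suc d} z<s))
  ...   | zero  , o , eq , p∤o = contradiction (subst (p ∣_) (trans eq (+-identityʳ o)) p∣2^[1+d]∸1) p∤o
  ...   | suc v , o , eq , p∤o with even⊎odd v
  ...     | s , inj₂ refl = suc d , s , o , eq , p∤o
  ...     | s , inj₁ refl = suc d * p , s , subst (λ y → p ^ suc (suc (2 * s)) ∥ y ∸ 1) (^-*-assoc 2 (suc d) p)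
                                                  (∥-lift {w = 2 * s} pp p≢2 (m^n>0 2 (suc d)) (o , eq , p∤o))

  oddPrime^[2+2s]≡5+4t : Prime p → p ≢ 2 → ∀ s → ∃[ t ] p ^ suc (suc (2 * s)) ≡ 5 + 4 * t
  oddPrime^[2+2s]≡5+4t {p} pp p≢2 s with ∤2⇒odd (∤-^ prime[2] (prime≢2⇒2∤p pp p≢2) (suc s))
  ... | zero  , p^[1+s]≡1    = contradiction (subst (p ∣_) p^[1+s]≡1 (m∣m*n (p ^ s))) (prime∤1 pp)
  ... | suc a , p^[1+s]≡3+2a = a + suc a * suc a , (begin
    p ^ suc (suc (2 * s))                ≡⟨ cong (p ^_) (double s) ⟩
    p ^ (suc s + suc s)                  ≡⟨ ^-distribˡ-+-* p (suc s) (suc s) ⟩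
    p ^ suc s * p ^ suc s                ≡⟨ cong₂ _*_ p^[1+s]≡3+2a p^[1+s]≡3+2a ⟩
    suc (2 * suc a) * suc (2 * suc a)    ≡⟨ square a ⟩
    5 + 4 * (a + suc a * suc a)          ∎)
    where
    double : ∀ s → suc (suc (2 * s)) ≡ suc s + suc s
    double = solve-∀
    square : ∀ a → suc (2 * suc a) * suc (2 * suc a) ≡ 5 + 4 * (a + suc a * suc a)
    square = solve-∀

  [N+2]CN*N-odd : ∀ t → ∃[ X ] (((5 + 4 * t) + 2) C (5 + 4 * t)) * (5 + 4 * t) ≡ suc (2 * X)
  [N+2]CN*N-odd t = X , (begin
    ((N + 2) C N) * N    ≡⟨ cong (_* N) (trans ([m+n]Cm≡[m+n]Cn N 2) (cong (_C 2) (+-comm N 2))) ⟩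
    ((2 + N) C 2) * N    ≡⟨ cong (_* N) (*-cancelˡ-≡ ((2 + N) C 2) M 2 (trans (2*[1+n]C2≡[1+n]*n (suc N)) (halve t))) ⟩
    M * N                ≡⟨ expand t ⟩
    suc (2 * X)          ∎)
    where
    N = 5 + 4 * t
    M = (7 + 4 * t) * (3 + 2 * t)
    X = 52 + 107 * t + 72 * (t * t) + 16 * (t * t * t)
    halve : ∀ t → (7 + 4 * t) * (6 + 4 * t) ≡ 2 * ((7 + 4 * t) * (3 + 2 * t))
    halve = solve-∀
    expand : ∀ t → (7 + 4 * t) * (3 + 2 * t) * (5 + 4 * t) ≡ suc (2 * (52 + 107 * t + 72 * (t * t) + 16 * (t * t * t)))
    expand = solve-∀

  evenValuations : ∀ {r} → Prime r → r ≢ 2 →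
                   ∃[ w ] 2 ^ suc (suc w) ∥ r ^ 2 ∸ 1 × 2 ^ suc (suc (suc w)) ∥ r ^ 4 ∸ 1
  evenValuations {r} pr r≢2 with oddPrime pr r≢2
  ... | h , r≡3+2h with ∃-exactPower {n = suc h * (2 + h)} prime[2] (s≤s z≤n)
  ...   | w , o , eq , 2∤o =
    w , r²∥ , subst (λ y → 2 ^ suc (suc (suc w)) ∥ y ∸ 1) (^-*-assoc r 2 2) (∥-lift-2 {w = w} (m^n>0 r 2) r²∥)
    where
    instance _ = prime⇒nonZero pr
    square : ∀ h → (3 + 2 * h) * ((3 + 2 * h) * 1) ≡ suc (2 * (2 * (suc h * (2 + h))))
    square = solve-∀
    r²∥ : 2 ^ suc (suc w) ∥ r ^ 2 ∸ 1
    r²∥ = o , cong (_∸ 1) (begin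
      r ^ 2                              ≡⟨ cong (_^ 2) r≡3+2h ⟩
      (3 + 2 * h) ^ 2                    ≡⟨ square h ⟩
      suc (2 * (2 * (suc h * (2 + h))))  ≡⟨ cong (λ g → suc (2 * (2 * g))) eq ⟩
      suc (2 * (2 * (2 ^ w * o)))        ≡⟨ cong (λ g → suc (2 * g)) (*-assoc 2 (2 ^ w) o) ⟨
      suc (2 * (2 ^ suc w * o))          ≡⟨ cong suc (*-assoc 2 (2 ^ suc w) o) ⟨
      suc (2 ^ suc (suc w) * o)          ∎) , 2∤o

  0<m<n+n∧n∣m⇒m≡n : 0 < m → m < n + n → n ∣ m → m ≡ n
  0<m<n+n∧n∣m⇒m≡n 0<m _     (divides zero          refl) = contradiction 0<m (<-irrefl refl)
  0<m<n+n∧n∣m⇒m≡n {n = n} _ _ (divides (suc zero) refl) = +-identityʳ n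
  0<m<n+n∧n∣m⇒m≡n {n = n} _ m<2n (divides (suc (suc q)) refl) =
    contradiction (+-monoʳ-≤ n (m≤m+n n (q * n))) (<⇒≱ m<2n)

open Arithmetic

module SumProperties {c ℓ} (M : CommutativeMonoid c ℓ) where
  open CommutativeMonoid M
    renaming (_∙_ to _+_; ε to 0#; ∙-cong to +-cong; ∙-congˡ to +-congˡ;
              identityˡ to +-identityˡ; identityʳ to +-identityʳ; comm to +-comm)
  open import Algebra.Properties.CommutativeMonoid.Sum M public
  open import Algebra.Properties.CommutativeMonoid.Mult M using (_×_; ×-distrib-+)
  open import Relation.Binary.Reasoning.Setoid setoid

  ∑-single : ∀ n (g : ℕ → Carrier) t → t ℕ.< n → (∀ j → j ℕ.< n → j ≢ t → g j ≈ 0#) →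
             ∑[ i < n ] g (toℕ i) ≈ g t
  ∑-single (suc n) g zero    _         g≈0 = begin
    g 0 + ∑[ i < n ] g (suc (toℕ i))  ≈⟨ +-congˡ (sum-cong-≋ λ i → g≈0 _ (s<s (toℕ<n i)) λ ()) ⟩
    g 0 + ∑[ i < n ] 0#               ≈⟨ +-congˡ (sum-replicate-zero n) ⟩
    g 0 + 0#                          ≈⟨ +-identityʳ (g 0) ⟩
    g 0                               ∎
  ∑-single (suc n) g (suc t) (s<s t<n) g≈0 = begin
    g 0 + ∑[ i < n ] g (suc (toℕ i))  ≈⟨ +-cong (g≈0 0 z<s λ ()) (∑-single n (g ∘ suc) t t<n λ j j<n j≢t →
                                                    g≈0 (suc j) (s<s j<n) (j≢t ∘ ℕ.suc-injective)) ⟩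
    0# + g (suc t)                    ≈⟨ +-identityˡ (g (suc t)) ⟩
    g (suc t)                         ∎

  ∑-rotate : ∀ n (g : ℕ → Carrier) → g n ≈ g 0 → ∑[ i < n ] g (suc (toℕ i)) ≈ ∑[ i < n ] g (toℕ i)
  ∑-rotate zero    g _       = refl
  ∑-rotate (suc n) g gn≈g0 = begin
    ∑[ i < suc n ] g (suc (toℕ i))
      ≈⟨ sum-init-last (λ i → g (suc (toℕ i))) ⟩
    ∑[ i < n ] g (suc (toℕ (inject₁ i))) + g (suc (toℕ (fromℕ n)))
      ≡⟨ ≡.cong₂ _+_ (sum-cong-≗ {n} (≡.cong (g ∘ suc) ∘ toℕ-inject₁)) (≡.cong (g ∘ suc) (toℕ-fromℕ n)) ⟩
    ∑[ i < n ] g (suc (toℕ i)) + g (suc n)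
      ≈⟨ +-congˡ gn≈g0 ⟩
    ∑[ i < n ] g (suc (toℕ i)) + g 0
      ≈⟨ +-comm _ (g 0) ⟩
    ∑[ i < suc n ] g (toℕ i)
      ∎

  ×-zeroʳ : ∀ k → k × 0# ≈ 0#
  ×-zeroʳ k = trans (sym (sum-replicate k)) (sum-replicate-zero k)

  ×-distrib-sum : ∀ k {n} (f : Vector Carrier n) → k × sum f ≈ ∑[ i < n ] (k × f i)
  ×-distrib-sum k {zero}  f = ×-zeroʳ k
  ×-distrib-sum k {suc n} f = trans (×-distrib-+ (head f) (sum (tail f)) k) (+-congˡ (×-distrib-sum k (tail f)))

module CommutativeSemiringProperties {c ℓ} (R : CommutativeSemiring c ℓ) where
  open CommutativeSemiring R
  open import Algebra.Properties.Semiring.Exp semiring using (_^_; ^-congˡ; ^-congʳ; ^-assocʳ)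
  open import Algebra.Properties.Semiring.Mult semiring using (_×_; ×-congʳ; ×-congˡ; ×-assocˡ; ×-assoc-*)
  open import Algebra.Properties.CommutativeSemiring.Binomial R using (theorem)
  open SumProperties +-commutativeMonoid using (sum-syntax; ∑-single)
  open import Relation.Binary.Reasoning.Setoid setoid

  1#^n≈1# : ∀ n → 1# ^ n ≈ 1#
  1#^n≈1# zero    = refl
  1#^n≈1# (suc n) = trans (*-identityˡ _) (1#^n≈1# n)

  r×1≈0⇒r×x≈0 : ∀ {r} → r × 1# ≈ 0# → ∀ x → r × x ≈ 0#
  r×1≈0⇒r×x≈0 {r} r≈0 x = begin
    r × x          ≈⟨ ×-congʳ r (*-identityˡ x) ⟨
    r × (1# * x)   ≈⟨ ×-assoc-* r 1# x ⟨
    (r × 1#) * x   ≈⟨ *-congʳ r≈0 ⟩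
    0# * x         ≈⟨ zeroˡ x ⟩
    0#             ∎

  frobenius : ∀ {r} → Prime r → r × 1# ≈ 0# → ∀ x y → (x + y) ^ r ≈ x ^ r + y ^ r
  frobenius {suc r} pr r≈0 x y = begin
    (x + y) ^ suc r                             ≈⟨ theorem (suc r) x y ⟩
    term 0 + ∑[ j < suc r ] term (suc (toℕ j))  ≈⟨ +-congˡ (∑-single (suc r) _ r (ℕ.n<1+n r) middle≈0) ⟩
    term 0 + term (suc r)                       ≈⟨ +-cong first last ⟩
    y ^ suc r + x ^ suc r                       ≈⟨ +-comm (y ^ suc r) (x ^ suc r) ⟩
    x ^ suc r + y ^ suc r                       ∎
    where
    term : ℕ → Carrier
    term j = (suc r C j) × (x ^ j * y ^ (suc r ∸ j))
    first : term 0 ≈ y ^ suc r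
    first = trans (+-identityʳ _) (*-identityˡ _)
    last : term (suc r) ≈ x ^ suc r
    last = trans (×-congˡ (nCn≡1 (suc r))) (trans (+-identityʳ _)
             (trans (*-congˡ (^-congʳ y (ℕ.n∸n≡0 r))) (*-identityʳ _)))
    middle≈0 : ∀ j → j ℕ.< suc r → j ≢ r → term (suc j) ≈ 0#
    middle≈0 j j<1+r j≢r with p∣pCk pr z<s (s<s (ℕ.≤∧≢⇒< (ℕ.≤-pred j<1+r) j≢r))
    ... | divides q C≡q*r = begin
      (suc r C suc j) × z       ≈⟨ ×-congˡ (≡.trans C≡q*r (ℕ.*-comm q (suc r))) ⟩
      (suc r ℕ.* q) × z         ≈⟨ ×-assocˡ z (suc r) q ⟨
      suc r × (q × z)           ≈⟨ r×1≈0⇒r×x≈0 {suc r} r≈0 (q × z) ⟩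
      0#                        ∎
      where z = x ^ suc j * y ^ (suc r ∸ suc j)

  frobenius-^ : ∀ {r} → Prime r → r × 1# ≈ 0# →
                ∀ e x y → (x + y) ^ (r ℕ.^ e) ≈ x ^ (r ℕ.^ e) + y ^ (r ℕ.^ e)
  frobenius-^ pr r≈0 zero    x y = trans (*-identityʳ _) (+-cong (sym (*-identityʳ x)) (sym (*-identityʳ y)))
  frobenius-^ {r} pr r≈0 (suc e) x y = begin
    (x + y) ^ (r ℕ.* r ℕ.^ e)              ≈⟨ ^-assocʳ (x + y) r (r ℕ.^ e) ⟨
    ((x + y) ^ r) ^ (r ℕ.^ e)              ≈⟨ ^-congˡ (r ℕ.^ e) (frobenius pr r≈0 x y) ⟩
    (x ^ r + y ^ r) ^ (r ℕ.^ e)            ≈⟨ frobenius-^ pr r≈0 e (x ^ r) (y ^ r) ⟩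
    (x ^ r) ^ (r ℕ.^ e) + (y ^ r) ^ (r ℕ.^ e) ≈⟨ +-cong (^-assocʳ x r _) (^-assocʳ y r _) ⟩
    x ^ (r ℕ.* r ℕ.^ e) + y ^ (r ℕ.* r ℕ.^ e) ∎

module DiscreteFieldProperties {c ℓ} (F : DiscreteField c ℓ) where
  open DiscreteField F
  open import Algebra.Properties.Semiring.Exp semiring using (_^_)
  open import Algebra.Properties.Semiring.Mult semiring using (_×_; ×1-homo-*)
  open import Relation.Binary.Reasoning.Setoid setoid

  private
    variable
      x y : Carrier

  1≉0 : ¬ 1# ≈ 0#
  1≉0 = 0≉1 ∘ sym

  invertible⇒≉0 : Invertible _≈_ 1# _*_ x → ¬ x ≈ 0#
  invertible⇒≉0 {x} (x⁻¹ , x⁻¹x≈1 , _) x≈0 =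
    1≉0 (trans (sym x⁻¹x≈1) (trans (*-congˡ x≈0) (zeroʳ x⁻¹)))

  *-almostCancelˡ : AlmostLeftCancellative _≈_ 0# _*_
  *-almostCancelˡ x y z x≉0 xy≈xz with zero-or-unit x
  ... | inj₁ x≈0                = contradiction x≈0 x≉0
  ... | inj₂ (x⁻¹ , x⁻¹x≈1 , _) = begin
    y                ≈⟨ *-identityˡ y ⟨
    1# * y           ≈⟨ *-congʳ x⁻¹x≈1 ⟨
    (x⁻¹ * x) * y    ≈⟨ *-assoc x⁻¹ x y ⟩
    x⁻¹ * (x * y)    ≈⟨ *-congˡ xy≈xz ⟩
    x⁻¹ * (x * z)    ≈⟨ *-assoc x⁻¹ x z ⟨
    (x⁻¹ * x) * z    ≈⟨ *-congʳ x⁻¹x≈1 ⟩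
    1# * z           ≈⟨ *-identityˡ z ⟩
    z                ∎

  x≉0∧xy≈0⇒y≈0 : ¬ x ≈ 0# → x * y ≈ 0# → y ≈ 0#
  x≉0∧xy≈0⇒y≈0 {x} {y} x≉0 xy≈0 = *-almostCancelˡ x y 0# x≉0 (trans xy≈0 (sym (zeroʳ x)))

  *-≉0 : ¬ x ≈ 0# → ¬ y ≈ 0# → ¬ x * y ≈ 0#
  *-≉0 x≉0 y≉0 = y≉0 ∘ x≉0∧xy≈0⇒y≈0 x≉0

  ^-≉0 : ¬ x ≈ 0# → ∀ n → ¬ x ^ n ≈ 0#
  ^-≉0 x≉0 zero    = 1≉0
  ^-≉0 x≉0 (suc n) = *-≉0 x≉0 (^-≉0 x≉0 n)

  xy≈y∧x≉1⇒y≈0 : x * y ≈ y → ¬ x ≈ 1# → y ≈ 0#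
  xy≈y∧x≉1⇒y≈0 {x} {y} xy≈y x≉1 with zero-or-unit y
  ... | inj₁ y≈0 = y≈0
  ... | inj₂ y-invertible = contradiction
    (*-almostCancelˡ y x 1# (invertible⇒≉0 y-invertible) (trans (*-comm y x) (trans xy≈y (sym (*-identityʳ y)))))
    x≉1

  ι : ℕ → Carrier
  ι n = n × 1#

  ι-* : ∀ m n → ι (m ℕ.* n) ≈ ι m * ι n
  ι-* = ×1-homo-*

  ι-^ : ∀ m n → ι (m ℕ.^ n) ≈ ι m ^ n
  ι-^ m zero    = +-identityʳ 1#
  ι-^ m (suc n) = trans (ι-* m (m ℕ.^ n)) (*-congˡ (ι-^ m n))

  ι2≈0⇒ι[1+2n]≈1 : ι 2 ≈ 0# → ∀ n → ι (suc (2 ℕ.* n)) ≈ 1#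
  ι2≈0⇒ι[1+2n]≈1 ι2≈0 n = begin
    1# + ι (2 ℕ.* n)   ≈⟨ +-congˡ (ι-* 2 n) ⟩
    1# + ι 2 * ι n     ≈⟨ +-congˡ (trans (*-congʳ ι2≈0) (zeroˡ (ι n))) ⟩
    1# + 0#            ≈⟨ +-identityʳ 1# ⟩
    1#                 ∎

  ι≈0⇒∃prime : ∀ {n} → 0 ℕ.< n → ι n ≈ 0# → ∃[ r ] Prime r ∧ ι r ≈ 0#
  ι≈0⇒∃prime {n} n>0 ιn≈0 =
    go factors factorsPrime (trans (reflexive (≡.cong ι (≡.sym isFactorisation))) ιn≈0)
    where
    open PrimeFactorisation (factorise n {{ℕ.>-nonZero n>0}})
    go : ∀ as → All Prime as → ι (product as) ≈ 0# → ∃[ r ] Prime r ∧ ι r ≈ 0#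
    go []       []         ι1≈0 = contradiction (trans (sym (+-identityʳ 1#)) ι1≈0) 1≉0
    go (a ∷ as) (pa ∷ pas) ι[a*as]≈0 with zero-or-unit (ι a)
    ... | inj₁ ιa≈0        = a , pa , ιa≈0
    ... | inj₂ ιa-invertible =
      go as pas (x≉0∧xy≈0⇒y≈0 (invertible⇒≉0 ιa-invertible) (trans (sym (ι-* a (product as))) ι[a*as]≈0))

module PrüferUnits {c ℓ} (p : ℕ) (pp : Prime p) (F : DiscreteField c ℓ) (iso : MultGroupIsoCp∞ p F) where
  open DiscreteField F
  open MultGroupIsoCp∞ iso
  open DiscreteFieldProperties F
  open CommutativeSemiringProperties commutativeSemiring using (1#^n≈1#; frobenius; frobenius-^)
  open SumProperties +-commutativeMonoid
    using (sum-syntax; sum-cong-≋; sum-replicate; ∑-comm; ∑-single; ∑-rotate; ×-zeroʳ; ×-distrib-sum)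
  open import Algebra.Properties.Semiring.Sum semiring using (*-distribˡ-sum)
  open import Algebra.Properties.Semiring.Exp semiring using (_^_; ^-congˡ; ^-homo-*)
  open import Algebra.Properties.Semiring.Mult semiring using (_×_; ×-congʳ; ×-congˡ; ×-assocˡ)
  open import Algebra.Properties.CommutativeSemiring.Exp commutativeSemiring using (^-distrib-*)
  open import Algebra.Properties.CommutativeSemiring.Binomial commutativeSemiring using (theorem)
  open import Algebra.Properties.Group +-group using (∙-cancelˡ)
  open import Algebra.Properties.Ring ring using (-1*x≈-x; -‿involutive)
  open import Relation.Binary.Reasoning.Setoid setoid
  open import Data.Integer as ℤ using (ℤ; +_; ∣_∣)
  import Data.Integer.Properties as ℤ
  import Data.Integer.Divisibility as ℤ
  import Data.Nat.Divisibility as ℕ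
  open import Algebra.Properties.CommutativeSemigroup ℕ.*-commutativeSemigroup using (xy∙z≈y∙xz)

  private
    variable
      x : Carrier
      a b : ℤ
      m o : ℕ

    P : ℕ → ℤ
    P k = + (p ℕ.^ k)

    instance
      p≢0 : ℕ.NonZero p
      p≢0 = prime⇒nonZero pp

  ≡-cross⇒≈Cp : ∀ a n b m → a ℤ.* P m ≡ b ℤ.* P n → _≈Cp_ p (a , n) (b , m)
  ≡-cross⇒≈Cp a n b m aPm≡bPn = ≡.subst (P (n ℕ.+ m) ℤ.∣_) (≡.sym aPm-bPn≡0) (ℕ._∣0 _)
    where
    aPm-bPn≡0 : a ℤ.* P m ℤ.- b ℤ.* P n ≡ + 0
    aPm-bPn≡0 = ≡.trans (≡.cong (ℤ._- b ℤ.* P n) aPm≡bPn) (ℤ.+-inverseʳ (b ℤ.* P n))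

  ψ-+ : ∀ a b m → ψ (a , m) * ψ (b , m) ≈ ψ (a ℤ.+ b , m)
  ψ-+ a b m = sym (trans (ψ-cong (a ℤ.+ b , m) (d , m ℕ.+ m) (≡-cross⇒≈Cp (a ℤ.+ b) m d (m ℕ.+ m) cross))
                         (ψ-hom (a , m) (b , m)))
    where
    d = a ℤ.* P m ℤ.+ b ℤ.* P m
    P[m+m]≡Pm*Pm : P (m ℕ.+ m) ≡ P m ℤ.* P m
    P[m+m]≡Pm*Pm = ≡.trans (≡.cong +_ (ℕ.^-distribˡ-+-* p m m)) (ℤ.pos-* (p ℕ.^ m) (p ℕ.^ m))
    cross : (a ℤ.+ b) ℤ.* P (m ℕ.+ m) ≡ d ℤ.* P m
    cross = ≡.trans (≡.cong ((a ℤ.+ b) ℤ.*_) P[m+m]≡Pm*Pm)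
              (≡.trans (≡.sym (ℤ.*-assoc (a ℤ.+ b) (P m) (P m))) (≡.cong (ℤ._* P m) (ℤ.*-distribʳ-+ (P m) a b)))

  ψ-cong-≡ : a ≡ b → ψ (a , m) ≈ ψ (b , m)
  ψ-cong-≡ ≡.refl = refl

  ψ₀≈1 : ψ (+ 0 , 0) ≈ 1#
  ψ₀≈1 = *-almostCancelˡ ψ₀ ψ₀ 1# (ψ-nonzero (+ 0 , 0)) (trans (ψ-+ (+ 0) (+ 0) 0) (sym (*-identityʳ ψ₀)))
    where ψ₀ = ψ (+ 0 , 0)

  private
    b*p⁰-0*pᵐ≡b : ∀ b m → b ℤ.* P 0 ℤ.- + 0 ℤ.* P m ≡ b
    b*p⁰-0*pᵐ≡b b m = ≡.trans (ℤ.+-identityʳ (b ℤ.* + 1)) (ℤ.*-identityʳ b)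

  ψ≈1⇒p^m∣b : ∀ b m → ψ (b , m) ≈ 1# → p ℕ.^ m ℕ.∣ ∣ b ∣
  ψ≈1⇒p^m∣b b m ψ≈1 = ≡.subst₂ ℤ._∣_ (≡.cong P (ℕ.+-identityʳ m)) (b*p⁰-0*pᵐ≡b b m)
    (ψ-injective (b , m) (+ 0 , 0) (trans ψ≈1 (sym ψ₀≈1)))

  p^m∣b⇒ψ≈1 : ∀ b m → p ℕ.^ m ℕ.∣ ∣ b ∣ → ψ (b , m) ≈ 1#
  p^m∣b⇒ψ≈1 b m p^m∣b = trans (ψ-cong (b , m) (+ 0 , 0)
    (≡.subst₂ ℤ._∣_ (≡.cong P (≡.sym (ℕ.+-identityʳ m))) (≡.sym (b*p⁰-0*pᵐ≡b b m)) p^m∣b)) ψ₀≈1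

  ψ-^ : ∀ b m k → ψ (b , m) ^ k ≈ ψ (+ k ℤ.* b , m)
  ψ-^ b m zero    = sym (p^m∣b⇒ψ≈1 (+ 0) m (ℕ._∣0 _))
  ψ-^ b m (suc k) = begin
    ψ (b , m) * ψ (b , m) ^ k        ≈⟨ *-congˡ (ψ-^ b m k) ⟩
    ψ (b , m) * ψ (+ k ℤ.* b , m)    ≈⟨ ψ-+ b (+ k ℤ.* b) m ⟩
    ψ (b ℤ.+ + k ℤ.* b , m)          ≈⟨ ψ-cong-≡ (≡.cong (ℤ._+ + k ℤ.* b) (ℤ.*-identityˡ b)) ⟨
    ψ (+ 1 ℤ.* b ℤ.+ + k ℤ.* b , m)  ≈⟨ ψ-cong-≡ (ℤ.*-distribʳ-+ b (+ 1) (+ k)) ⟨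
    ψ (+ suc k ℤ.* b , m)            ∎

  ψ^k≈1⇒p^m∣k*b : ∀ b m k → ψ (b , m) ^ k ≈ 1# → p ℕ.^ m ℕ.∣ k ℕ.* ∣ b ∣
  ψ^k≈1⇒p^m∣k*b b m k ψ^k≈1 =
    ≡.subst (p ℕ.^ m ℕ.∣_) (ℤ.abs-* (+ k) b) (ψ≈1⇒p^m∣b (+ k ℤ.* b) m (trans (sym (ψ-^ b m k)) ψ^k≈1))

  p^m∣k*b⇒ψ^k≈1 : ∀ b m k → p ℕ.^ m ℕ.∣ k ℕ.* ∣ b ∣ → ψ (b , m) ^ k ≈ 1#
  p^m∣k*b⇒ψ^k≈1 b m k p^m∣kb =
    trans (ψ-^ b m k) (p^m∣b⇒ψ≈1 (+ k ℤ.* b) m (≡.subst (p ℕ.^ m ℕ.∣_) (≡.sym (ℤ.abs-* (+ k) b)) p^m∣kb))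

  ^[n*o]≈1⇒^n≈1 : ∀ n → ¬ p ℕ.∣ o → ¬ x ≈ 0# → x ^ (n ℕ.* o) ≈ 1# → x ^ n ≈ 1#
  ^[n*o]≈1⇒^n≈1 {o} {x} n p∤o x≉0 x^no≈1 with ψ-surjective x x≉0
  ... | (b , m) , ψ≈x =
    trans (^-congˡ n (sym ψ≈x)) (p^m∣k*b⇒ψ^k≈1 b m n (p^k∣o*n⇒p^k∣n pp p∤o m p^m∣o*[n*b]))
    where
    p^m∣o*[n*b] : p ℕ.^ m ℕ.∣ o ℕ.* (n ℕ.* ∣ b ∣)
    p^m∣o*[n*b] = ≡.subst (p ℕ.^ m ℕ.∣_) (xy∙z≈y∙xz n o ∣ b ∣)
                    (ψ^k≈1⇒p^m∣k*b b m (n ℕ.* o) (trans (^-congˡ (n ℕ.* o) ψ≈x) x^no≈1))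

  ^[1+n*o]≈x⇒^[1+n]≈x : ∀ n → ¬ p ℕ.∣ o → x ^ suc (n ℕ.* o) ≈ x → x ^ suc n ≈ x
  ^[1+n*o]≈x⇒^[1+n]≈x {o} {x} n p∤o x^[1+no]≈x with zero-or-unit x
  ... | inj₁ x≈0 = trans (*-congʳ x≈0) (trans (zeroˡ _) (sym x≈0))
  ... | inj₂ x-invertible = trans (*-congˡ (^[n*o]≈1⇒^n≈1 n p∤o x≉0 x^no≈1)) (*-identityʳ x)
    where
    x≉0 : ¬ x ≈ 0#
    x≉0 = invertible⇒≉0 x-invertible
    x^no≈1 : x ^ (n ℕ.* o) ≈ 1#
    x^no≈1 = *-almostCancelˡ x (x ^ (n ℕ.* o)) 1# x≉0 (trans x^[1+no]≈x (sym (*-identityʳ x)))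

  ¬ι[p]≈0 : ¬ ι p ≈ 0#
  ¬ι[p]≈0 ιp≈0 = ^-≉0 y≉0 p y^p≈0
    where
    ζ y : Carrier
    ζ = ψ (+ 1 , 1)
    y = ζ - 1#
    y+1≈ζ : y + 1# ≈ ζ
    y+1≈ζ = begin
      ζ + - 1# + 1#      ≈⟨ +-assoc ζ (- 1#) 1# ⟩
      ζ + (- 1# + 1#)    ≈⟨ +-congˡ (-‿inverseˡ 1#) ⟩
      ζ + 0#             ≈⟨ +-identityʳ ζ ⟩
      ζ                  ∎
    y≉0 : ¬ y ≈ 0#
    y≉0 y≈0 = prime∤1 pp (ψ≈1⇒p^m∣b (+ 1) 1 (begin
      ζ          ≈⟨ y+1≈ζ ⟨
      y + 1#     ≈⟨ +-congʳ y≈0 ⟩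
      0# + 1#    ≈⟨ +-identityˡ 1# ⟩
      1#         ∎) |> ≡.subst (ℕ._∣ 1) (ℕ.*-identityʳ p))
    y^p≈0 : y ^ p ≈ 0#
    y^p≈0 = ∙-cancelˡ 1# (y ^ p) 0# (begin
      1# + y ^ p         ≈⟨ +-comm 1# (y ^ p) ⟩
      y ^ p + 1#         ≈⟨ +-congˡ (1#^n≈1# p) ⟨
      y ^ p + 1# ^ p     ≈⟨ frobenius pp ιp≈0 y 1# ⟨
      (y + 1#) ^ p       ≈⟨ ^-congˡ p y+1≈ζ ⟩
      ζ ^ p              ≈⟨ p^m∣k*b⇒ψ^k≈1 (+ 1) 1 p ℕ.∣-refl ⟩
      1#                 ≈⟨ +-identityʳ 1# ⟨
      1# + 0#            ∎)

  p≢2⇒ι2≈0 : p ≢ 2 → ι 2 ≈ 0#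
  p≢2⇒ι2≈0 p≢2 = begin
    1# + (1# + 0#)   ≈⟨ +-congˡ (+-identityʳ 1#) ⟩
    1# + 1#          ≈⟨ +-congˡ -1≈1 ⟨
    1# + - 1#        ≈⟨ -‿inverseʳ 1# ⟩
    0#               ∎
    where
    -1≉0 : ¬ - 1# ≈ 0#
    -1≉0 -1≈0 = 1≉0 (begin
      1#          ≈⟨ +-identityʳ 1# ⟨
      1# + 0#     ≈⟨ +-congˡ -1≈0 ⟨
      1# + - 1#   ≈⟨ -‿inverseʳ 1# ⟩
      0#          ∎)
    [-1]²≈1 : (- 1#) ^ (1 ℕ.* 2) ≈ 1#
    [-1]²≈1 = begin
      - 1# * (- 1# * 1#)  ≈⟨ *-congˡ (*-identityʳ (- 1#)) ⟩
      - 1# * - 1#         ≈⟨ -1*x≈-x (- 1#) ⟩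
      - - 1#              ≈⟨ -‿involutive 1# ⟩
      1#                  ∎
    -1≈1 : - 1# ≈ 1#
    -1≈1 = trans (sym (*-identityʳ (- 1#))) (^[n*o]≈1⇒^n≈1 1 (prime≢2⇒p∤2 pp p≢2) -1≉0 [-1]²≈1)

  ∃-characteristic : ∃[ r ] Prime r ∧ ι r ≈ 0#
  ∃-characteristic with zero-or-unit (ι 2)
  ... | inj₁ ι2≈0          = 2 , prime[2] , ι2≈0
  ... | inj₂ ι2-invertible with ψ-surjective (ι 2) (invertible⇒≉0 ι2-invertible)
  ...   | (b , m) , ψ≈ι2 = ι≈0⇒∃prime (ℕ.m<n⇒0<n∸m 1<2^K) (∙-cancelˡ 1# _ 0# (begin
    ι (suc (2 ℕ.^ K ∸ 1))  ≡⟨ ≡.cong ι (ℕ.m+[n∸m]≡n (ℕ.<⇒≤ 1<2^K)) ⟩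
    ι (2 ℕ.^ K)            ≈⟨ ι-^ 2 K ⟩
    ι 2 ^ K                ≈⟨ ^-congˡ K ψ≈ι2 ⟨
    ψ (b , m) ^ K          ≈⟨ p^m∣k*b⇒ψ^k≈1 b m K (ℕ.∣m⇒∣m*n ∣ b ∣ ℕ.∣-refl) ⟩
    1#                     ≈⟨ +-identityʳ 1# ⟨
    1# + 0#                ∎))
    where
    K = p ℕ.^ m
    1<2^K : 1 ℕ.< 2 ℕ.^ K
    1<2^K = ℕ.^-monoʳ-< 2 (ℕ.s≤s (ℕ.s≤s ℕ.z≤n)) (ℕ.m^n>0 p m)

  module RootsOfUnity (w : ℕ) where
    N : ℕ
    N = p ℕ.^ w

    ζ : ℕ → Carrier
    ζ a = ψ (+ a , w)

    ζ^≈1⇒N∣ : ∀ a j → ζ a ^ j ≈ 1# → N ℕ.∣ j ℕ.* a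
    ζ^≈1⇒N∣ a = ψ^k≈1⇒p^m∣k*b (+ a) w

    N∣⇒ζ^≈1 : ∀ a j → N ℕ.∣ j ℕ.* a → ζ a ^ j ≈ 1#
    N∣⇒ζ^≈1 a = p^m∣k*b⇒ψ^k≈1 (+ a) w

    S : ℕ → Carrier
    S j = ∑[ a < N ] (ζ (toℕ a) ^ j)

    S-∣ : ∀ j → N ℕ.∣ j → S j ≈ ι N
    S-∣ j N∣j = trans (sum-cong-≋ {N} λ a → N∣⇒ζ^≈1 (toℕ a) j (ℕ.∣m⇒∣m*n (toℕ a) N∣j))
                      (sum-replicate N)

    S-∤ : ∀ j → ¬ N ℕ.∣ j → S j ≈ 0#
    S-∤ j N∤j =
      xy≈y∧x≉1⇒y≈0 rotation-invariant (N∤j ∘ ≡.subst (N ℕ.∣_) (ℕ.*-identityʳ j) ∘ ζ^≈1⇒N∣ 1 j)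
      where
      g : ℕ → Carrier
      g a = ζ a ^ j
      gN≈g0 : g N ≈ g 0
      gN≈g0 = trans (N∣⇒ζ^≈1 N j (ℕ.∣n⇒∣m*n j ℕ.∣-refl))
                    (sym (N∣⇒ζ^≈1 0 j (≡.subst (N ℕ.∣_) (≡.sym (ℕ.*-zeroʳ j)) (N ℕ.∣0))))
      rotation-invariant : ζ 1 ^ j * S j ≈ S j
      rotation-invariant = begin
        ζ 1 ^ j * S j                        ≈⟨ *-distribˡ-sum {N} (ζ 1 ^ j) (g ∘ toℕ) ⟩
        ∑[ a < N ] (ζ 1 ^ j * g (toℕ a))     ≈⟨ sum-cong-≋ {N} (λ a → trans (sym (^-distrib-* (ζ 1) _ j))
                                                                         (^-congˡ j (ψ-+ (+ 1) (+ toℕ a) w))) ⟩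
        ∑[ a < N ] g (suc (toℕ a))           ≈⟨ ∑-rotate N g gN≈g0 ⟩
        S j                                  ∎

    ζ+1-periodic : ∀ {r e o} → Prime r → ι r ≈ 0# → r ℕ.^ e ≡ suc (N ℕ.* o) → ¬ p ℕ.∣ o →
                   ∀ a → (ζ a + 1#) ^ suc N ≈ ζ a + 1#
    ζ+1-periodic {r} {e} {o} pr ιr≈0 r^e≡ p∤o a = ^[1+n*o]≈x⇒^[1+n]≈x N p∤o (begin
      (ζ a + 1#) ^ suc (N ℕ.* o)            ≡⟨ ≡.cong ((ζ a + 1#) ^_) r^e≡ ⟨
      (ζ a + 1#) ^ (r ℕ.^ e)                ≈⟨ frobenius-^ pr ιr≈0 e (ζ a) 1# ⟩
      ζ a ^ (r ℕ.^ e) + 1# ^ (r ℕ.^ e)      ≈⟨ +-cong (reflexive (≡.cong (ζ a ^_) r^e≡)) (1#^n≈1# (r ℕ.^ e)) ⟩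
      ζ a * ζ a ^ (N ℕ.* o) + 1#            ≈⟨ +-congʳ (*-congˡ (N∣⇒ζ^≈1 a (N ℕ.* o) N∣N*o*a)) ⟩
      ζ a * 1# + 1#                         ≈⟨ +-congʳ (*-identityʳ (ζ a)) ⟩
      ζ a + 1#                              ∎)
      where
      N∣N*o*a : N ℕ.∣ N ℕ.* o ℕ.* a
      N∣N*o*a = ℕ.∣m⇒∣m*n a (ℕ.∣m⇒∣m*n o ℕ.∣-refl)

    module PowerSums (periodic : ∀ a → (ζ a + 1#) ^ suc N ≈ ζ a + 1#) where
      T : ℕ → Carrier
      T n = ∑[ a < N ] ((ζ (toℕ a) + 1#) ^ n)

      T≈∑CS : ∀ n → T n ≈ ∑[ j < suc n ] ((n C toℕ j) × S (toℕ j))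
      T≈∑CS n = begin
        ∑[ a < N ] ((ζ (toℕ a) + 1#) ^ n)
          ≈⟨ sum-cong-≋ {N} (binomial ∘ ζ ∘ toℕ) ⟩
        ∑[ a < N ] ∑[ j < suc n ] term (toℕ j) (ζ (toℕ a))
          ≈⟨ ∑-comm {N} {suc n} (λ a j → term (toℕ j) (ζ (toℕ a))) ⟩
        ∑[ j < suc n ] ∑[ a < N ] term (toℕ j) (ζ (toℕ a))
          ≈⟨ sum-cong-≋ {suc n} (λ j → sym (×-distrib-sum (n C toℕ j) {N} (λ a → ζ (toℕ a) ^ toℕ j))) ⟩
        ∑[ j < suc n ] ((n C toℕ j) × S (toℕ j))
          ∎
        where
        term : ℕ → Carrier → Carrier
        term j x = (n C j) × x ^ j
        binomial : ∀ x → (x + 1#) ^ n ≈ ∑[ j < suc n ] term (toℕ j) x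
        binomial x = trans (theorem n x 1#) (sum-cong-≋ {suc n} λ j →
          ×-congʳ (n C toℕ j) (trans (*-congˡ (1#^n≈1# (n ∸ toℕ j))) (*-identityʳ (x ^ toℕ j))))

      T-periodic : ∀ k → T (N ℕ.+ suc k) ≈ T (suc k)
      T-periodic k = sum-cong-≋ {N} λ a → let y = ζ (toℕ a) + 1# in begin
        y ^ (N ℕ.+ suc k)      ≡⟨ ≡.cong (y ^_) (ℕ.+-suc N k) ⟩
        y ^ (suc N ℕ.+ k)      ≈⟨ ^-homo-* y (suc N) k ⟩
        y ^ suc N * y ^ k      ≈⟨ *-congʳ (periodic (toℕ a)) ⟩
        y * y ^ k              ∎

      [N+k]CN×ιN≈0 : ∀ k → 0 ℕ.< k → k ℕ.< N → ((N ℕ.+ k) C N) × ι N ≈ 0#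
      [N+k]CN×ιN≈0 (suc k) _ k<N = ∙-cancelˡ (ι N) _ 0# (begin
        ι N + (n C N) × ι N      ≈⟨ T[n]≈ ⟨
        T n                      ≈⟨ T-periodic k ⟩
        T (suc k)                ≈⟨ T[1+k]≈ιN ⟩
        ι N                      ≈⟨ +-identityʳ (ι N) ⟨
        ι N + 0#                 ∎)
        where
        n = N ℕ.+ suc k
        N' = ℕ.pred N
        1+N'≡N : suc N' ≡ N
        1+N'≡N = ℕ.suc-pred N {{ℕ.m^n≢0 p w}}
        T[n]≈ : T n ≈ ι N + (n C N) × ι N
        T[n]≈ = begin
          T n
            ≈⟨ T≈∑CS n ⟩
          (n C 0) × S 0 + ∑[ j < n ] ((n C suc (toℕ j)) × S (suc (toℕ j)))
            ≈⟨ +-cong (trans (+-identityʳ (S 0)) (S-∣ 0 (N ℕ.∣0))) (∑-single n _ N' N'<n middle≈0) ⟩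
          ι N + (n C suc N') × S (suc N')
            ≡⟨ ≡.cong (λ m → ι N + (n C m) × S m) 1+N'≡N ⟩
          ι N + (n C N) × S N
            ≈⟨ +-congˡ (×-congʳ (n C N) (S-∣ N ℕ.∣-refl)) ⟩
          ι N + (n C N) × ι N
            ∎
          where
          N'<n : N' ℕ.< n
          N'<n = ℕ.<-≤-trans (≡.subst (N' ℕ.<_) 1+N'≡N (ℕ.n<1+n N')) (ℕ.m≤m+n N (suc k))
          middle≈0 : ∀ j → j ℕ.< n → j ≢ N' → (n C suc j) × S (suc j) ≈ 0#
          middle≈0 j j<n j≢N' = trans (×-congʳ (n C suc j) (S-∤ (suc j) λ N∣1+j →
            j≢N' (ℕ.suc-injective (≡.trans (0<m<n+n∧n∣m⇒m≡n ℕ.z<s 1+j<N+N N∣1+j) (≡.sym 1+N'≡N)))))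
            (×-zeroʳ (n C suc j))
            where
            1+j<N+N : suc j ℕ.< N ℕ.+ N
            1+j<N+N = ℕ.≤-<-trans j<n (ℕ.+-monoʳ-< N k<N)
        T[1+k]≈ιN : T (suc k) ≈ ι N
        T[1+k]≈ιN = begin
          T (suc k)                                          ≈⟨ T≈∑CS (suc k) ⟩
          ∑[ j < suc (suc k) ] ((suc k C toℕ j) × S (toℕ j))  ≈⟨ ∑-single (suc (suc k)) _ 0 ℕ.z<s nonzero≈0 ⟩
          (suc k C 0) × S 0                                  ≈⟨ trans (+-identityʳ (S 0)) (S-∣ 0 (N ℕ.∣0)) ⟩
          ι N                                                ∎
          where
          nonzero≈0 : ∀ j → j ℕ.< suc (suc k) → j ≢ 0 → (suc k C j) × S j ≈ 0#
          nonzero≈0 j j<2+k j≢0 = trans (×-congʳ (suc k C j) (S-∤ j λ N∣j →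
            ℕ.<⇒≱ (ℕ.<-≤-trans j<2+k k<N) (ℕ.∣⇒≤ {{ℕ.≢-nonZero j≢0}} N∣j))) (×-zeroʳ (suc k C j))

  binomial-vanishes : ∀ {r e w k} → Prime r → ι r ≈ 0# → p ^ w ∥ r ℕ.^ e ∸ 1 →
                      0 ℕ.< k → k ℕ.< p ℕ.^ w → ι (((p ℕ.^ w ℕ.+ k) C p ℕ.^ w) ℕ.* p ℕ.^ w) ≈ 0#
  binomial-vanishes {r} {e} {w} {k} pr ιr≈0 (o , r^e∸1≡ , p∤o) k>0 k<N =
    trans (sym (×-assocˡ 1# ((N ℕ.+ k) C N) N)) ([N+k]CN×ιN≈0 k k>0 k<N)
    where
    open RootsOfUnity w
    r^e≡ : r ℕ.^ e ≡ suc (N ℕ.* o)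
    r^e≡ = ≡.trans (≡.sym (ℕ.m+[n∸m]≡n (ℕ.m^n>0 r {{prime⇒nonZero pr}} e))) (≡.cong suc r^e∸1≡)
    open PowerSums (ζ+1-periodic {e = e} pr ιr≈0 r^e≡ p∤o)

  ι[1+p^w]≈0 : ∀ {r e w} → Prime r → ι r ≈ 0# → p ^ w ∥ r ℕ.^ e ∸ 1 →
               0 ℕ.< w → ι (suc (p ℕ.^ w)) ≈ 0#
  ι[1+p^w]≈0 {e = e} {w = w} pr ιr≈0 p^w∥ w>0 = x≉0∧xy≈0⇒y≈0 ιN≉0 (begin
    ι N * ι (suc N)              ≈⟨ *-comm (ι N) (ι (suc N)) ⟩
    ι (suc N) * ι N              ≈⟨ ι-* (suc N) N ⟨
    ι (suc N ℕ.* N)              ≡⟨ ≡.cong (λ c → ι (c ℕ.* N)) [N+1]CN≡1+N ⟨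
    ι (((N ℕ.+ 1) C N) ℕ.* N)    ≈⟨ binomial-vanishes {e = e} {w = w} pr ιr≈0 p^w∥ ℕ.z<s 1<N ⟩
    0#                           ∎)
    where
    N = p ℕ.^ w
    ιN≉0 : ¬ ι N ≈ 0#
    ιN≉0 = ^-≉0 ¬ι[p]≈0 w ∘ trans (sym (ι-^ p w))
    1<N : 1 ℕ.< N
    1<N = ℕ.^-monoʳ-< p (ℕ.nonTrivial⇒n>1 p {{prime⇒nonTrivial pp}}) w>0
    [N+1]CN≡1+N : (N ℕ.+ 1) C N ≡ suc N
    [N+1]CN≡1+N = ≡.trans ([m+n]Cm≡[m+n]Cn N 1) (≡.trans (nC1≡n (N ℕ.+ 1)) (ℕ.+-comm N 1))

¬MultGroupIso-odd : ∀ {c ℓ p} → Prime p → p ≢ 2 → (F : DiscreteField c ℓ) → ¬ MultGroupIsoCp∞ p F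
¬MultGroupIso-odd {p = p} pp p≢2 F iso =
  let e , s , p^w∥      = oddValuation pp p≢2
      t , N≡5+4t        = oddPrime^[2+2s]≡5+4t pp p≢2 s
      X , [N+2]CN*N≡1+2X = [N+2]CN*N-odd t
      w = suc (suc (2 ℕ.* s))
      N = p ℕ.^ w
      2<N : 2 ℕ.< N
      2<N = ≡.subst (2 ℕ.<_) (≡.sym N≡5+4t) (ℕ.s≤s (ℕ.s≤s (ℕ.s≤s ℕ.z≤n)))
  in 1≉0 (begin
    1#
      ≈⟨ ι2≈0⇒ι[1+2n]≈1 ι2≈0 X ⟨
    ι (suc (2 ℕ.* X))
      ≡⟨ ≡.cong ι (≡.trans (≡.cong (λ N → ((N ℕ.+ 2) C N) ℕ.* N) N≡5+4t) [N+2]CN*N≡1+2X) ⟨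
    ι (((N ℕ.+ 2) C N) ℕ.* N)
      ≈⟨ binomial-vanishes {e = e} {w = w} {k = 2} prime[2] ι2≈0 p^w∥ (ℕ.s≤s ℕ.z≤n) 2<N ⟩
    0#
      ∎)
  where
  open DiscreteField F
  open DiscreteFieldProperties F
  open PrüferUnits p pp F iso using (p≢2⇒ι2≈0; binomial-vanishes)
  open import Relation.Binary.Reasoning.Setoid setoid
  ι2≈0 : ι 2 ≈ 0#
  ι2≈0 = p≢2⇒ι2≈0 p≢2

¬MultGroupIso-2 : ∀ {c ℓ} (F : DiscreteField c ℓ) → ¬ MultGroupIsoCp∞ 2 F
¬MultGroupIso-2 F iso =
  let r , pr , ιr≈0            = ∃-characteristic
      w , 2^[2+w]∥ , 2^[3+w]∥ = evenValuations pr (λ r≡2 → ¬ι[p]≈0 (≡.subst (λ n → ι n ≈ 0#) r≡2 ιr≈0))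
      A = 2 ℕ.^ suc (suc w)
  in 1≉0 (begin
    1#                   ≈⟨ +-identityʳ 1# ⟨
    1# + 0#              ≈⟨ +-congˡ (ι[1+p^w]≈0 {e = 4} {w = suc (suc (suc w))} pr ιr≈0 2^[3+w]∥ ℕ.z<s) ⟨
    ι (2 ℕ.+ 2 ℕ.* A)    ≡⟨ ≡.cong ι (ℕ.*-suc 2 A) ⟨
    ι (2 ℕ.* suc A)      ≈⟨ ι-* 2 (suc A) ⟩
    ι 2 * ι (suc A)      ≈⟨ *-congˡ (ι[1+p^w]≈0 {e = 2} {w = suc (suc w)} pr ιr≈0 2^[2+w]∥ ℕ.z<s) ⟩
    ι 2 * 0#             ≈⟨ zeroʳ (ι 2) ⟩
    0#                   ∎)
  where
  open DiscreteField F
  open DiscreteFieldProperties F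
  open PrüferUnits 2 prime[2] F iso using (∃-characteristic; ¬ι[p]≈0; ι[1+p^w]≈0)
  open import Relation.Binary.Reasoning.Setoid setoid

mainTheorem5 : ∀ {c ℓ} (p : ℕ) → Prime p → (F : DiscreteField c ℓ) → ¬ MultGroupIsoCp∞ p F
mainTheorem5 p pp F with p ℕ.≟ 2
... | yes ≡.refl = ¬MultGroupIso-2 F
... | no p≢2     = ¬MultGroupIso-odd pp p≢2 F
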